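{- For every digraph $G$, $\mathrm{d\text{ - }cutw}(G)\le\min(\Delta^-(G),\Delta^+(G))\cdot\mathrm{d\text{ - }pw}(G)$.
   Context: Digraphs $G=(V,E)$ are finite with $E\subseteq\{(u,v):u\ne v\}$; $\Delta^+(G),\Delta^-(G)$ are the maximum out-degree and maximum in-degree. A layout is a bijection $\varphi:V\to\{1,\dots,|V|\}$; $L(i,\varphi)=\{u:\varphi(u)\le i\}$, $R(i,\varphi)=\{u:\varphi(u)>i\}$. $\mathrm{d\text{ - }pw}(G)$ is the minimum of $\max|X_i|-1$ over sequences $(X_1,\dots,X_r)$ of subsets of $V$ with $\bigcup X_i=V$, for each $(u,v)\in E$ some $i\le j$ with $u\in X_i,v\in X_j$, and $X_i\cap X_\ell\subseteq X_j$ for $i<j<\ell$. $\mathrm{d\text{ - }cutw}(G)=\min_\varphi\max_i|\{(u,v)\in E:u\in L(i,\varphi),v\in R(i,\varphi)\}|$. -}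

module Defs where

open import Data.Nat using (ℕ; zero; suc; _+_; _∸_; _⊔_; _<_; _≤_; _≤ᵇ_; _<ᵇ_)
open import Data.Bool using (Bool; true; false; _∧_; if_then_else_)
open import Data.Fin using (Fin; toℕ)
open import Data.Fin.Subset using (Subset; _∈_; ∣_∣)
open import Data.List using (List; foldr; map; allFin)
open import Data.Nat.ListAction using (sum)
open import Data.Product using (Σ; _×_; ∃; ∃-syntax)
open import Function.Bundles using (_⤖_; Bijection)
open import Relation.Binary.PropositionalEquality using (_≡_)

record Digraph (n : ℕ) : Set where
  field
    adj    : Fin n → Fin n → Bool
    noLoop : ∀ v → adj v v ≡ false
open Digraph public

-- maximum of a finite family of naturals (0 for the empty family)
maxFin : ∀ {r} → (Fin r → ℕ) → ℕ
maxFin {r} f = foldr _⊔_ 0 (map f (allFin r))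

sumFin : ∀ {r} → (Fin r → ℕ) → ℕ
sumFin {r} f = sum (map f (allFin r))

b2n : Bool → ℕ
b2n true  = 1
b2n false = 0

outDeg : ∀ {n} → Digraph n → Fin n → ℕ
outDeg G u = sumFin (λ v → b2n (adj G u v))

inDeg : ∀ {n} → Digraph n → Fin n → ℕ
inDeg G v = sumFin (λ u → b2n (adj G u v))

Δ⁺ : ∀ {n} → Digraph n → ℕ
Δ⁺ G = maxFin (outDeg G)

Δ⁻ : ∀ {n} → Digraph n → ℕ
Δ⁻ G = maxFin (inDeg G)

record DPathDecomp {n : ℕ} (G : Digraph n) : Set where
  field
    r      : ℕ
    bag    : Fin r → Subset n
    cover  : ∀ v → ∃[ i ] (v ∈ bag i)
    edges  : ∀ u v → adj G u v ≡ true →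
             ∃[ i ] ∃[ j ] (toℕ i ≤ toℕ j × u ∈ bag i × v ∈ bag j)
    interp : ∀ (i j l : Fin r) → toℕ i < toℕ j → toℕ j < toℕ l →
             ∀ v → v ∈ bag i → v ∈ bag l → v ∈ bag j
open DPathDecomp public

dpdWidth : ∀ {n} {G : Digraph n} → DPathDecomp G → ℕ
dpdWidth D = maxFin (λ i → ∣ bag D i ∣) ∸ 1

IsDPW : ∀ {n} → Digraph n → ℕ → Set
IsDPW G p = (∃[ D ] (dpdWidth {G = G} D ≡ p)) × (∀ (D : DPathDecomp G) → p ≤ dpdWidth D)

-- A layout: bijection V → {1..n}, realised 0-based as Fin n.
Layout : ℕ → Set
Layout n = Fin n ⤖ Fin n

-- number of edges (u,v) with φ(u) ≤ i < φ(v) (1-based), i.e. u ∈ L(i,φ), v ∈ R(i,φ)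
cutAt : ∀ {n} → Digraph n → Layout n → ℕ → ℕ
cutAt {n} G φ i = sumFin (λ u → sumFin (λ v →
    b2n (adj G u v ∧ (toℕ (f u) <ᵇ i) ∧ (i ≤ᵇ toℕ (f v)))))
  where f = Bijection.to φ

layoutCutw : ∀ {n} → Digraph n → Layout n → ℕ
layoutCutw {n} G φ = maxFin {suc n} (λ i → cutAt G φ (toℕ i))

IsDCutw : ∀ {n} → Digraph n → ℕ → Set
IsDCutw G c = (∃[ φ ] (layoutCutw G φ ≡ c)) × (∀ φ → c ≤ layoutCutw G φ)

module Submission where

-- Fix a directed path decomposition D of width W.  List the vertices in
-- non-increasing order of the LAST bag containing them.  If w is the first
-- vertex after a cut and (u,v) an edge crossing it, then
-- last(v) ≤ last(w) ≤ last(u); since u lies in a bag no later than one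
-- containing v, and the bags containing u form an interval, u lies in the
-- last bag of w.  So all tails of crossing edges lie in that bag minus w,
-- a set of at most W vertices, and the cut has at most Δ⁺ · W edges.
-- Symmetrically, ordering by the FIRST bag bounds every cut by Δ⁻ · W via
-- the heads of crossing edges.  The cut width is therefore at most both.

open import Defs
open import Data.Nat using (ℕ; zero; suc; pred; s≤s⁻¹; _+_; _*_; _⊔_; _⊓_; _≤_; _<_; _<ᵇ_; _≤ᵇ_; z≤n; s≤s)
open import Data.Nat.Properties
import Data.Nat.ListAction as ListAction
open import Data.Bool using (Bool; true; false; _∧_; T)
open import Data.Bool.Properties using (T-∧; T-≡)
open import Data.Unit using (tt)
open import Data.Product using (Σ-syntax; ∃-syntax; _×_; _,_; proj₁; proj₂)
open import Data.Sum as Sum using (_⊎_; inj₁; inj₂)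
open import Data.Fin as Fin using (Fin; toℕ; fromℕ<; punchOut; combine)
open import Data.Fin.Properties as Finₚ
  using (toℕ<n; toℕ-injective; toℕ-fromℕ<; any?; injective⇒≤; punchOut-injective; combine-injectiveʳ; combine-monoˡ-<)
open import Data.Fin.Subset using (Subset; _∈_; ∣_∣)
open import Data.Fin.Subset.Properties using (_∈?_)
open import Data.Vec using (_∷_; []; lookup)
open import Data.Vec.Properties using ([]=⇒lookup)
open import Data.List using (tabulate)
open import Data.List.Properties using (map-tabulate; foldr-preservesᵇ; foldr-preservesᵒ)
open import Data.List.Membership.Propositional.Properties using (∈-allFin; ∈-map⁺)
open import Data.List.Relation.Unary.All.Properties using (tabulate⁺; map⁺)
import Data.List.Relation.Unary.Any as Any
open import Algebra.Properties.Semiring.Sum +-*-semiring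
  using (sum; sum-syntax; ∑-comm; *-distribˡ-sum; *-distribʳ-sum; sum-cong-≗)
open import Function using (_∘_; id; Equivalence)
open import Function.Bundles using (Bijection; mk⤖)
open import Function.Definitions using (Injective; StrictlySurjective)
open import Function.Consequences.Propositional using (strictlySurjective⇒surjective)
open import Relation.Nullary using (¬_; contradiction; yes; no; Dec)
open import Relation.Binary using (tri<; tri≈; tri>)
open import Relation.Binary.PropositionalEquality

-- The list-based sums of Defs agree with the library's sums over Fin n,
-- so the library's algebra of finite sums (∑-comm, distributivity) applies.
sum-tabulate : ∀ {n} (f : Fin n → ℕ) → ListAction.sum (tabulate f) ≡ sum f
sum-tabulate {zero}  f = refl
sum-tabulate {suc n} f = cong (f Fin.zero +_) (sum-tabulate (f ∘ Fin.suc))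

sumFin≡∑ : ∀ {n} (f : Fin n → ℕ) → sumFin f ≡ ∑[ x < n ] f x
sumFin≡∑ f = trans (cong ListAction.sum (map-tabulate id f)) (sum-tabulate f)

maxFin-ub : ∀ {n} (f : Fin n → ℕ) i → f i ≤ maxFin f
maxFin-ub f i = foldr-preservesᵒ below-⊔ 0 _ (inj₂ (Any.map ≤-reflexive (∈-map⁺ f (∈-allFin i))))
  where
  below-⊔ : ∀ x y → f i ≤ x ⊎ f i ≤ y → f i ≤ x ⊔ y
  below-⊔ x y = Sum.[ m≤n⇒m≤n⊔o y , m≤n⇒m≤o⊔n x ]

maxFin-lub : ∀ {n} (f : Fin n → ℕ) {B} → (∀ i → f i ≤ B) → maxFin f ≤ B
maxFin-lub f {B} f≤B = foldr-preservesᵇ {P = _≤ B} ⊔-lub z≤n (map⁺ (tabulate⁺ f≤B))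

∑-mono : ∀ {n} {f g : Fin n → ℕ} → (∀ x → f x ≤ g x) → sum f ≤ sum g
∑-mono {zero}  f≤g = z≤n
∑-mono {suc n} f≤g = +-mono-≤ (f≤g Fin.zero) (∑-mono (f≤g ∘ Fin.suc))

∑-mono-< : ∀ {n} {f g : Fin n → ℕ} → (∀ x → f x ≤ g x) → ∀ y → f y < g y → sum f < sum g
∑-mono-< f≤g Fin.zero    fy<gy = +-mono-<-≤ fy<gy (∑-mono (f≤g ∘ Fin.suc))
∑-mono-< f≤g (Fin.suc y) fy<gy = +-mono-≤-< (f≤g Fin.zero) (∑-mono-< (f≤g ∘ Fin.suc) y fy<gy)

b2n-mono : ∀ {a b} → (T a → T b) → b2n a ≤ b2n b
b2n-mono {false}         a⇒b = z≤n
b2n-mono {true}  {true}  a⇒b = ≤-refl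
b2n-mono {true}  {false} a⇒b = contradiction (a⇒b _) λ ()

b2n-∧ : ∀ a b → b2n (a ∧ b) ≡ b2n a * b2n b
b2n-∧ false b = refl
b2n-∧ true  b = sym (*-identityˡ (b2n b))

count : ∀ {n} → (Fin n → Bool) → ℕ
count p = ∑[ x < _ ] b2n (p x)

count-< : ∀ {n} {p q : Fin n → Bool} → (∀ x → T (p x) → T (q x)) →
          ∀ w → T (q w) → ¬ T (p w) → count p < count q
count-< {p = p} {q} p⇒q w qw ¬pw = ∑-mono-< (λ x → b2n-mono (p⇒q x)) w (witness (p w) (q w) qw ¬pw)
  where
  witness : ∀ a b → T b → ¬ T a → b2n a < b2n b
  witness false true _ _ = s≤s z≤n
  witness true  _    _ ¬a = contradiction _ ¬a

count-∈ : ∀ {n} (B : Subset n) → count (lookup B) ≡ ∣ B ∣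
count-∈ []          = refl
count-∈ (true  ∷ B) = cong suc (count-∈ B)
count-∈ (false ∷ B) = count-∈ B

count-all : ∀ n → count {n} (λ _ → true) ≡ n
count-all zero    = refl
count-all (suc n) = cong suc (count-all n)

count-none : ∀ n → count {n} (λ _ → false) ≡ 0
count-none zero    = refl
count-none (suc n) = count-none n

∈⇒T : ∀ {n} {x : Fin n} {B : Subset n} → x ∈ B → T (lookup B x)
∈⇒T x∈B = subst T (sym ([]=⇒lookup x∈B)) tt

least-index : ∀ {r} (P : Fin r → Set) → (∀ i → Dec (P i)) → ∃[ i ] P i →
              Σ[ m ∈ Fin r ] (P m × (∀ j → P j → toℕ m ≤ toℕ j))
least-index {suc r} P P? (w , pw) with P? Fin.zero
... | yes p0 = Fin.zero , p0 , λ _ _ → z≤n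
least-index {suc r} P P? (Fin.zero  , pw) | no ¬p0 = contradiction pw ¬p0
least-index {suc r} P P? (Fin.suc w , pw) | no ¬p0
  with m , pm , m-least ← least-index (P ∘ Fin.suc) (P? ∘ Fin.suc) (w , pw) =
  Fin.suc m , pm , λ { Fin.zero p0 → contradiction p0 ¬p0 ; (Fin.suc j) pj → s≤s (m-least j pj) }

greatest-index : ∀ {r} (P : Fin r → Set) → (∀ i → Dec (P i)) → ∃[ i ] P i →
                 Σ[ m ∈ Fin r ] (P m × (∀ j → P j → toℕ j ≤ toℕ m))
greatest-index {suc r} P P? (w , pw) with any? (P? ∘ Fin.suc)
... | yes later with m , pm , m-greatest ← greatest-index (P ∘ Fin.suc) (P? ∘ Fin.suc) later =
  Fin.suc m , pm , λ { Fin.zero _ → z≤n ; (Fin.suc j) pj → s≤s (m-greatest j pj) }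
greatest-index {suc r} P P? (Fin.zero  , pw) | no ¬later =
  Fin.zero , pw , λ { Fin.zero _ → z≤n ; (Fin.suc j) pj → contradiction (j , pj) ¬later }
greatest-index {suc r} P P? (Fin.suc w , pw) | no ¬later = contradiction (w , pw) ¬later

module Degrees {n : ℕ} (G : Digraph n) where

  ∑-tails : (c : Fin n → ℕ) →
            ∑[ u < n ] ∑[ v < n ] (b2n (adj G u v) * c u) ≤ Δ⁺ G * ∑[ u < n ] c u
  ∑-tails c = begin
    ∑[ u < n ] ∑[ v < n ] (b2n (adj G u v) * c u)  ≡⟨ sum-cong-≗ row ⟩
    ∑[ u < n ] (outDeg G u * c u)                  ≤⟨ ∑-mono (λ u → *-monoˡ-≤ (c u) (maxFin-ub (outDeg G) u)) ⟩
    ∑[ u < n ] (Δ⁺ G * c u)                        ≡⟨ *-distribˡ-sum (Δ⁺ G) c ⟨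
    Δ⁺ G * ∑[ u < n ] c u                          ∎
    where
    open ≤-Reasoning
    row : ∀ u → ∑[ v < n ] (b2n (adj G u v) * c u) ≡ outDeg G u * c u
    row u = trans (sym (*-distribʳ-sum (c u) (λ v → b2n (adj G u v))))
                  (cong (_* c u) (sym (sumFin≡∑ (λ v → b2n (adj G u v)))))

  ∑-heads : (c : Fin n → ℕ) →
            ∑[ u < n ] ∑[ v < n ] (b2n (adj G u v) * c v) ≤ Δ⁻ G * ∑[ v < n ] c v
  ∑-heads c = begin
    ∑[ u < n ] ∑[ v < n ] (b2n (adj G u v) * c v)  ≡⟨ ∑-comm (λ u v → b2n (adj G u v) * c v) ⟩
    ∑[ v < n ] ∑[ u < n ] (b2n (adj G u v) * c v)  ≡⟨ sum-cong-≗ column ⟩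
    ∑[ v < n ] (inDeg G v * c v)                   ≤⟨ ∑-mono (λ v → *-monoˡ-≤ (c v) (maxFin-ub (inDeg G) v)) ⟩
    ∑[ v < n ] (Δ⁻ G * c v)                        ≡⟨ *-distribˡ-sum (Δ⁻ G) c ⟨
    Δ⁻ G * ∑[ v < n ] c v                          ∎
    where
    open ≤-Reasoning
    column : ∀ v → ∑[ u < n ] (b2n (adj G u v) * c v) ≡ inDeg G v * c v
    column v = trans (sym (*-distribʳ-sum (c v) (λ u → b2n (adj G u v))))
                     (cong (_* c v) (sym (sumFin≡∑ (λ u → b2n (adj G u v)))))

-- Pigeonhole: an injective endomap of Fin n is onto.  If y were missed,
-- punching y out would give an injection Fin n → Fin (n - 1).
injective⇒onto : ∀ {n} (f : Fin n → Fin n) → Injective _≡_ _≡_ f → StrictlySurjective _≡_ f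
injective⇒onto {suc m} f f-inj y with any? (λ x → f x Fin.≟ y)
... | yes hit = hit
... | no miss = contradiction (injective⇒≤ g-inj) 1+n≰n
  where
  y≢f : ∀ x → y ≢ f x
  y≢f x y≡fx = miss (x , sym y≡fx)
  g : Fin (suc m) → Fin m
  g x = punchOut (y≢f x)
  g-inj : Injective _≡_ _≡_ g
  g-inj gx≡gy = f-inj (punchOut-injective (y≢f _) (y≢f _) gx≡gy)

position : ∀ {n} → Layout n → Fin n → ℕ
position φ u = toℕ (Bijection.to φ u)

vertex-at : ∀ {n} (φ : Layout n) {i} → i < n → ∃[ w ] (position φ w ≡ i)
vertex-at φ i<n with Bijection.surjective φ (fromℕ< i<n)
... | w , to≡ = w , trans (cong toℕ (to≡ refl)) (toℕ-fromℕ< i<n)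

-- Ties are broken by the vertex itself: vertices are ranked by the
-- injective code (key u, u), and a vertex is placed after all vertices
-- with a larger code.
module AntitoneLayout {n m : ℕ} (key : Fin n → Fin m) where

  code : Fin n → Fin (m * n)
  code u = combine (key u) u

  above : Fin n → Fin n → Bool
  above u w = toℕ (code u) <ᵇ toℕ (code w)

  not-above-self : ∀ u → ¬ T (above u u)
  not-above-self u cu<cu = <-irrefl refl (<ᵇ⇒< (toℕ (code u)) _ cu<cu)

  rank : Fin n → ℕ
  rank u = count (above u)

  rank<n : ∀ u → rank u < n
  rank<n u = subst (rank u <_) (count-all n)
    (count-< {p = above u} (λ _ _ → _) u _ (not-above-self u))

  rank-reverses : ∀ {u v} → toℕ (code u) < toℕ (code v) → rank v < rank u
  rank-reverses {u} {v} cu<cv = count-< {p = above v} {q = above u}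
    (λ w cv<cw → <⇒<ᵇ (<-trans cu<cv (<ᵇ⇒< (toℕ (code v)) (toℕ (code w)) cv<cw))) v (<⇒<ᵇ cu<cv) (not-above-self v)

  -- Codes are injective, so distinct vertices get distinct ranks.
  rank-injective : ∀ {u v} → rank u ≡ rank v → u ≡ v
  rank-injective {u} {v} ru≡rv with Finₚ.<-cmp (code u) (code v)
  ... | tri< cu<cv _ _ = contradiction (sym ru≡rv) (<⇒≢ (rank-reverses cu<cv))
  ... | tri≈ _ cu≡cv _ = combine-injectiveʳ (key u) u (key v) v cu≡cv
  ... | tri> _ _ cv<cu = contradiction ru≡rv (<⇒≢ (rank-reverses cv<cu))

  place : Fin n → Fin n
  place u = fromℕ< (rank<n u)

  place-injective : Injective _≡_ _≡_ place
  place-injective {u} {v} pu≡pv =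
    rank-injective (trans (sym (toℕ-fromℕ< (rank<n u))) (trans (cong toℕ pu≡pv) (toℕ-fromℕ< (rank<n v))))

  layout : Layout n
  layout = mk⤖ (place-injective , strictlySurjective⇒surjective (injective⇒onto place place-injective))

  antitone : ∀ {u v} → position layout u ≤ position layout v → toℕ (key v) ≤ toℕ (key u)
  antitone {u} {v} pu≤pv = ≮⇒≥ λ ku<kv →
    <⇒≱ (rank-reverses (combine-monoˡ-< u v ku<kv))
        (subst₂ _≤_ (toℕ-fromℕ< (rank<n u)) (toℕ-fromℕ< (rank<n v)) pu≤pv)

module Cuts {n : ℕ} (G : Digraph n) (φ : Layout n) where
  open Degrees G

  crosses : ℕ → Fin n → Fin n → Bool
  crosses i u v = adj G u v ∧ (position φ u <ᵇ i) ∧ (i ≤ᵇ position φ v)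

  crossing-edge : ∀ {i u v} → T (crosses i u v) → T (adj G u v) × position φ u < i × i ≤ position φ v
  crossing-edge {i} {u} {v} c with Equivalence.to T-∧ c
  ... | e , lr with Equivalence.to T-∧ lr
  ...   | l , r = e , <ᵇ⇒< (position φ u) i l , ≤ᵇ⇒≤ i (position φ v) r

  cutAt-∑ : ∀ i → cutAt G φ i ≡ ∑[ u < n ] ∑[ v < n ] b2n (crosses i u v)
  cutAt-∑ i = trans (sumFin≡∑ (λ u → sumFin (λ v → b2n (crosses i u v))))
                    (sum-cong-≗ (λ u → sumFin≡∑ (λ v → b2n (crosses i u v))))

  cut-by-tails : ∀ i (S : Fin n → Bool) {B} → (∀ u v → T (crosses i u v) → T (S u)) →
                 count S ≤ B → cutAt G φ i ≤ Δ⁺ G * B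
  cut-by-tails i S {B} tails S≤B = begin
    cutAt G φ i                                          ≡⟨ cutAt-∑ i ⟩
    ∑[ u < n ] ∑[ v < n ] b2n (crosses i u v)            ≤⟨ ∑-mono (λ u → ∑-mono (λ v → charge u v)) ⟩
    ∑[ u < n ] ∑[ v < n ] (b2n (adj G u v) * b2n (S u))  ≤⟨ ∑-tails (b2n ∘ S) ⟩
    Δ⁺ G * count S                                       ≤⟨ *-monoʳ-≤ (Δ⁺ G) S≤B ⟩
    Δ⁺ G * B                                             ∎
    where
    open ≤-Reasoning
    charge : ∀ u v → b2n (crosses i u v) ≤ b2n (adj G u v) * b2n (S u)
    charge u v = subst (b2n (crosses i u v) ≤_) (b2n-∧ (adj G u v) (S u))
      (b2n-mono λ c → Equivalence.from T-∧ (proj₁ (crossing-edge {i} c) , tails u v c))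

  cut-by-heads : ∀ i (S : Fin n → Bool) {B} → (∀ u v → T (crosses i u v) → T (S v)) →
                 count S ≤ B → cutAt G φ i ≤ Δ⁻ G * B
  cut-by-heads i S {B} heads S≤B = begin
    cutAt G φ i                                          ≡⟨ cutAt-∑ i ⟩
    ∑[ u < n ] ∑[ v < n ] b2n (crosses i u v)            ≤⟨ ∑-mono (λ u → ∑-mono (λ v → charge u v)) ⟩
    ∑[ u < n ] ∑[ v < n ] (b2n (adj G u v) * b2n (S v))  ≤⟨ ∑-heads (b2n ∘ S) ⟩
    Δ⁻ G * count S                                       ≤⟨ *-monoʳ-≤ (Δ⁻ G) S≤B ⟩
    Δ⁻ G * B                                             ∎
    where
    open ≤-Reasoning
    charge : ∀ u v → b2n (crosses i u v) ≤ b2n (adj G u v) * b2n (S v)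
    charge u v = subst (b2n (crosses i u v) ≤_) (b2n-∧ (adj G u v) (S v))
      (b2n-mono λ c → Equivalence.from T-∧ (proj₁ (crossing-edge {i} c) , heads u v c))

  cut-empty : ∀ i → (∀ u v → ¬ T (crosses i u v)) → cutAt G φ i ≡ 0
  cut-empty i uncrossed = n≤0⇒n≡0 (begin
    cutAt G φ i                     ≤⟨ cut-by-tails i (λ _ → false) uncrossed ≤-refl ⟩
    Δ⁺ G * count {n} (λ _ → false)  ≡⟨ cong (Δ⁺ G *_) (count-none n) ⟩
    Δ⁺ G * 0                        ≡⟨ *-zeroʳ (Δ⁺ G) ⟩
    0                               ∎)
    where open ≤-Reasoning

  cut-at-start : cutAt G φ 0 ≡ 0
  cut-at-start = cut-empty 0 λ u v c → n≮0 (proj₁ (proj₂ (crossing-edge {0} c)))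

  cut-beyond-end : ∀ {i} → n ≤ i → cutAt G φ i ≡ 0
  cut-beyond-end {i} n≤i = cut-empty i λ u v c →
    <⇒≱ (toℕ<n (Bijection.to φ v)) (≤-trans n≤i (proj₂ (proj₂ (crossing-edge {i} c))))

  before : Fin n → Fin n → Bool
  before w u = position φ u <ᵇ position φ w

  not-before-self : ∀ w → ¬ T (before w w)
  not-before-self w w<w = <-irrefl refl (<ᵇ⇒< (position φ w) (position φ w) w<w)

  cutw-bound : ∀ {B} → (∀ i → cutAt G φ i ≤ B) → layoutCutw G φ ≤ B
  cutw-bound cut≤B = maxFin-lub {suc n} (λ i → cutAt G φ (toℕ i)) (λ i → cut≤B (toℕ i))

module Decomposition {n : ℕ} {G : Digraph n} (D : DPathDecomp G) where

  interval : ∀ {v x t y} → v ∈ bag D x → v ∈ bag D y →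
             toℕ x ≤ toℕ t → toℕ t ≤ toℕ y → v ∈ bag D t
  interval {v} {x} {t} {y} v∈x v∈y x≤t t≤y with m≤n⇒m<n∨m≡n x≤t | m≤n⇒m<n∨m≡n t≤y
  ... | inj₂ x≡t | _        = subst (λ s → v ∈ bag D s) (toℕ-injective x≡t) v∈x
  ... | inj₁ _   | inj₂ t≡y = subst (λ s → v ∈ bag D s) (sym (toℕ-injective t≡y)) v∈y
  ... | inj₁ x<t | inj₁ t<y = interp D x t y x<t t<y v v∈x v∈y

  first : ∀ v → Σ[ m ∈ Fin (r D) ] (v ∈ bag D m × (∀ j → v ∈ bag D j → toℕ m ≤ toℕ j))
  first v = least-index (λ i → v ∈ bag D i) (λ i → v ∈? bag D i) (cover D v)

  last : ∀ v → Σ[ m ∈ Fin (r D) ] (v ∈ bag D m × (∀ j → v ∈ bag D j → toℕ j ≤ toℕ m))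
  last v = greatest-index (λ i → v ∈ bag D i) (λ i → v ∈? bag D i) (cover D v)

  firstBag lastBag : Fin n → Fin (r D)
  firstBag v = proj₁ (first v)
  lastBag  v = proj₁ (last v)

  tail-in-bag : ∀ {u v t} → T (adj G u v) →
                toℕ (lastBag v) ≤ toℕ t → toℕ t ≤ toℕ (lastBag u) → u ∈ bag D t
  tail-in-bag {u} {v} uv lv≤t t≤lu with a , b , a≤b , u∈a , v∈b ← edges D u v (Equivalence.to T-≡ uv) =
    interval u∈a (proj₁ (proj₂ (last u)))
      (≤-trans a≤b (≤-trans (proj₂ (proj₂ (last v)) b v∈b) lv≤t)) t≤lu

  head-in-bag : ∀ {u v t} → T (adj G u v) →
                toℕ (firstBag v) ≤ toℕ t → toℕ t ≤ toℕ (firstBag u) → v ∈ bag D t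
  head-in-bag {u} {v} uv fv≤t t≤fu with a , b , a≤b , u∈a , v∈b ← edges D u v (Equivalence.to T-≡ uv) =
    interval (proj₁ (proj₂ (first v))) v∈b
      fv≤t (≤-trans t≤fu (≤-trans (proj₂ (proj₂ (first u)) a u∈a) a≤b))

  -- Carving one member w out of bag t leaves at most width(D) vertices:
  -- a bag has at most width(D) + 1 elements.
  bag-minus-vertex : ∀ t w (S : Fin n → Bool) → w ∈ bag D t → ¬ T (S w) →
                     count (λ x → S x ∧ lookup (bag D t) x) ≤ dpdWidth D
  bag-minus-vertex t w S w∈t ¬Sw = begin
    count (λ x → S x ∧ lookup (bag D t) x)  ≤⟨ <⇒≤pred (<-≤-trans fewer (maxFin-ub (λ i → ∣ bag D i ∣) t)) ⟩
    pred (maxFin (λ i → ∣ bag D i ∣))       ≡⟨ pred[m∸n]≡m∸[1+n] (maxFin (λ i → ∣ bag D i ∣)) 0 ⟩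
    dpdWidth D                              ∎
    where
    open ≤-Reasoning
    fewer : count (λ x → S x ∧ lookup (bag D t) x) < ∣ bag D t ∣
    fewer = subst (count (λ x → S x ∧ lookup (bag D t) x) <_) (count-∈ (bag D t))
      (count-< {p = λ x → S x ∧ lookup (bag D t) x}
        (λ x Sx∧x∈t → proj₂ (Equivalence.to T-∧ Sx∧x∈t)) w (∈⇒T w∈t) (¬Sw ∘ proj₁ ∘ Equivalence.to T-∧))

-- Layout by non-increasing last bag.  When w is the first vertex after
-- cut i, every edge crossing the cut has its tail in the last bag of w,
-- and that tail is distinct from w.
module LastBagLayout {n : ℕ} {G : Digraph n} (D : DPathDecomp G) where
  open Decomposition D
  open AntitoneLayout lastBag public using (layout)
  open AntitoneLayout lastBag using (antitone)
  open Cuts G layout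

  cut-bound : ∀ i → cutAt G layout i ≤ Δ⁺ G * dpdWidth D
  cut-bound i with i <? n
  ... | no i≮n = ≤-trans (≤-reflexive (cut-beyond-end (≮⇒≥ i≮n))) z≤n
  ... | yes i<n with w , refl ← vertex-at layout i<n =
    cut-by-tails (position layout w) tail-set tails
      (bag-minus-vertex (lastBag w) w (before w) (proj₁ (proj₂ (last w))) (not-before-self w))
    where
    tail-set : Fin n → Bool
    tail-set u = before w u ∧ lookup (bag D (lastBag w)) u
    tails : ∀ u v → T (crosses (position layout w) u v) → T (tail-set u)
    tails u v c with uv , u<w , w≤v ← crossing-edge {position layout w} c =
      Equivalence.from T-∧ (<⇒<ᵇ u<w , ∈⇒T (tail-in-bag uv (antitone w≤v) (antitone (<⇒≤ u<w))))

-- Layout by non-increasing first bag.  When w is the last vertex before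
-- cut i, every edge crossing the cut has its head in the first bag of w,
-- and that head is distinct from w.
module FirstBagLayout {n : ℕ} {G : Digraph n} (D : DPathDecomp G) where
  open Decomposition D
  open AntitoneLayout firstBag public using (layout)
  open AntitoneLayout firstBag using (antitone)
  open Cuts G layout

  cut-bound : ∀ i → cutAt G layout i ≤ Δ⁻ G * dpdWidth D
  cut-bound zero = ≤-trans (≤-reflexive cut-at-start) z≤n
  cut-bound (suc j) with j <? n
  ... | no j≮n = ≤-trans (≤-reflexive (cut-beyond-end (m≤n⇒m≤1+n (≮⇒≥ j≮n)))) z≤n
  ... | yes j<n with w , refl ← vertex-at layout j<n =
    cut-by-heads (suc (position layout w)) head-set heads
      (bag-minus-vertex (firstBag w) w (λ v → before v w) (proj₁ (proj₂ (first w))) (not-before-self w))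
    where
    head-set : Fin n → Bool
    head-set v = before v w ∧ lookup (bag D (firstBag w)) v
    heads : ∀ u v → T (crosses (suc (position layout w)) u v) → T (head-set v)
    heads u v c with uv , u≤w , w<v ← crossing-edge {suc (position layout w)} c =
      Equivalence.from T-∧ (<⇒<ᵇ w<v , ∈⇒T (head-in-bag uv (antitone (<⇒≤ w<v)) (antitone (s≤s⁻¹ u≤w))))

lemma5p11 : ∀ {n} (G : Digraph n) (c p : ℕ) → IsDCutw G c → IsDPW G p →
    c ≤ (Δ⁻ G ⊓ Δ⁺ G) * p
lemma5p11 G c p (_ , c-optimal) ((D , refl) , _) = begin
  c                                                ≤⟨ ⊓-glb via-first-bags via-last-bags ⟩
  (Δ⁻ G * dpdWidth D) ⊓ (Δ⁺ G * dpdWidth D)        ≡⟨ *-distribʳ-⊓ (dpdWidth D) (Δ⁻ G) (Δ⁺ G) ⟨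
  (Δ⁻ G ⊓ Δ⁺ G) * dpdWidth D                       ∎
  where
  open ≤-Reasoning
  module F = FirstBagLayout D
  module L = LastBagLayout D
  via-first-bags : c ≤ Δ⁻ G * dpdWidth D
  via-first-bags = ≤-trans (c-optimal F.layout) (Cuts.cutw-bound G F.layout F.cut-bound)
  via-last-bags : c ≤ Δ⁺ G * dpdWidth D
  via-last-bags = ≤-trans (c-optimal L.layout) (Cuts.cutw-bound G L.layout L.cut-bound)
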